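{- Let $p=(12,\{(0,0),(0,1),(1,0),(1,1),(1,2)\})$. A permutation $\pi\in S_n$ avoids $p$ if and only if for every ascent $\pi_i<\pi_{i+1}$ there is an index $k<i$ with $\pi_i<\pi_k<\pi_{i+1}$ (so $\pi_k\pi_i\pi_{i+1}$ is a $213$ pattern whose $13$ is the ascent) or with $\pi_k<\pi_i$ (so $\pi_k\pi_i\pi_{i+1}$ is a $123$ pattern whose $23$ is the ascent), or both. Writing $a_n=|S_n(p)|$, we have $a_n=n\,a_{n-1}-a_{n-2}$ for $n\ge1$ with $a_{ -1}=0$, $a_0=1$.
   Context: $S_n$ is the set of permutations of $\{1,\dots,n\}$, written $\pi=\pi_1\cdots\pi_n$; an ascent is an index $i$ with $\pi_i<\pi_{i+1}$. A mesh pattern $(12,R)$ of length 2 has $R\subseteq\{0,1,2\}^2$ (shaded boxes). A permutation $\pi\in S_n$ contains $(12,R)$ if there exist indices $i<j$ with $\pi_i<\pi_j$ such that, with $p_0=0,p_1=i,p_2=j,p_3=n+1$ and $v_0=0,v_1=\pi_i,v_2=\pi_j,v_3=n+1$, for every $(a,b)\in R$ there is no index $x$ with $p_a<x<p_{a+1}$ and $v_b<\pi_x<v_{b+1}$. Otherwise $\pi$ avoids it; $S_n(p)$ is the set of avoiders in $S_n$. -}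

module Defs where

open import Data.Nat using (ℕ; zero; suc; _+_; _*_; _<_)
open import Data.Fin using (Fin; toℕ; zero; suc)
open import Data.Vec using (Vec; lookup)
open import Data.List using (List; length; []; _∷_)
open import Data.List.Relation.Unary.All using (All)
open import Data.List.Relation.Unary.Unique.Propositional using (Unique)
open import Data.List.Membership.Propositional using (_∈_)
open import Data.Product using (Σ; ∃; _×_; _,_)
open import Data.Sum using (_⊎_)
open import Relation.Nullary using (¬_)
open import Relation.Binary.PropositionalEquality using (_≡_)
open import Function.Bundles using (_⇔_)

-- A permutation of {1,…,n} is represented by its one-line notation
-- π = π₁⋯πₙ as a vector of length n with entries in Fin n
-- (value v : Fin n stands for v+1, positions likewise shifted by one);
-- it must be injective (hence bijective).
IsPerm : ∀ {n} → Vec (Fin n) n → Set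
IsPerm {n} π = ∀ (i j : Fin n) → lookup π i ≡ lookup π j → i ≡ j

-- A mesh pattern (12, R) of length 2: R is a list of shaded boxes (a,b),
-- a,b ∈ {0,1,2}.
MeshR : Set
MeshR = List (Fin 3 × Fin 3)

pos : ∀ {n} → Fin n → ℕ
pos i = suc (toℕ i)

-- boundary sequences p₀ = 0, p₁ = i, p₂ = j, p₃ = n+1 (1-based),
-- and v₀ = 0, v₁ = πᵢ, v₂ = πⱼ, v₃ = n+1.
bnd : (lo mid hi top : ℕ) → Fin 4 → ℕ
bnd lo mid hi top zero = lo
bnd lo mid hi top (suc zero) = mid
bnd lo mid hi top (suc (suc zero)) = hi
bnd lo mid hi top (suc (suc (suc zero))) = top

lowF : Fin 3 → Fin 4
lowF zero = zero
lowF (suc zero) = suc zero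
lowF (suc (suc zero)) = suc (suc zero)

highF : Fin 3 → Fin 4
highF a = suc a

BoxEmpty : ∀ {n} → Vec (Fin n) n → Fin n → Fin n → Fin 3 × Fin 3 → Set
BoxEmpty {n} π i j (a , b) =
  ∀ (x : Fin n) →
    ¬ ( (P (lowF a) < pos x × pos x < P (highF a))
      × (V (lowF b) < pos (lookup π x) × pos (lookup π x) < V (highF b)) )
  where
    P V : Fin 4 → ℕ
    P = bnd 0 (pos i) (pos j) (suc n)
    V = bnd 0 (pos (lookup π i)) (pos (lookup π j)) (suc n)

Contains : ∀ {n} → MeshR → Vec (Fin n) n → Set
Contains {n} R π =
  Σ (Fin n) λ i → Σ (Fin n) λ j →
    (toℕ i < toℕ j) × (toℕ (lookup π i) < toℕ (lookup π j))
    × All (BoxEmpty π i j) R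

Avoids : ∀ {n} → MeshR → Vec (Fin n) n → Set
Avoids R π = ¬ Contains R π

f0 f1 f2 : Fin 3
f0 = zero
f1 = suc zero
f2 = suc (suc zero)

pR : MeshR
pR = (f0 , f0) ∷ (f0 , f1) ∷ (f1 , f0) ∷ (f1 , f1) ∷ (f1 , f2) ∷ []

AscentCond : ∀ {n} → Vec (Fin n) n → Set
AscentCond {n} π =
  ∀ (i i' : Fin n) → toℕ i' ≡ suc (toℕ i) →
    toℕ (lookup π i) < toℕ (lookup π i') →
    Σ (Fin n) λ k → (toℕ k < toℕ i) ×
      ( (toℕ (lookup π i) < toℕ (lookup π k) × toℕ (lookup π k) < toℕ (lookup π i'))
      ⊎ toℕ (lookup π k) < toℕ (lookup π i) )

CardAvoiders : MeshR → ℕ → ℕ → Set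
CardAvoiders R n k =
  Σ (List (Vec (Fin n) n)) λ L →
    Unique L × (∀ π → (π ∈ L) ⇔ (IsPerm π × Avoids R π)) × length L ≡ k

-- An adjacent ascent πᵢ < πᵢ₊₁ without a witness k < i is an occurrence of p with all five
-- shaded boxes empty. Conversely, in an occurrence at positions i < j the entry at i + 1 lies
-- in a shaded box of column 1 unless j = i + 1, and then a witness k lies in box (0,0) or (0,1).
--
-- Every permutation of length n + 1 is σ followed by a new last value v, the values of σ that
-- are ≥ v being shifted up. This keeps the relative order of σ, so the extension satisfies the
-- ascent condition iff σ does and the new final ascent has a witness, which fails exactly when
-- σ ends in 0 and v = 1 (values counted from 0). If zₙ and wₙ count the good permutations of
-- length n ending in 0 and not, then zₙ₊₁ = aₙ and wₙ₊₁ = (n − 1) zₙ + n wₙ, whence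
-- aₙ₊₁ = (n + 1) aₙ − aₙ₋₁.

module Submission where

open import Defs
open import Data.Nat using (ℕ; zero; suc; pred; _+_; _*_; _<_; _≤_; z≤n; s≤s; s≤s⁻¹)
open import Data.Nat.Properties
  using (<-cmp; <⇒≱; <⇒≢; ≰⇒>; n≮0; 1+n≢n; <-irrefl; <-asym; ≤-trans; <-trans; ≤∧≢⇒<; n<1+n; m≤n⇒m<n∨m≡n; _<?_)
open import Data.Nat.Tactic.RingSolver using (solve-∀)
open import Data.Fin as Fin using (Fin; zero; suc; toℕ; fromℕ; fromℕ<; inject₁; punchIn; punchOut)
open import Data.Fin.Properties
  using (toℕ-injective; toℕ<n; toℕ-fromℕ; toℕ-fromℕ<; toℕ-inject₁; inject₁-injective; fromℕ≢inject₁;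
         punchIn-injective; punchInᵢ≢i; punchIn-mono-≤; punchIn-cancel-≤; punchIn-punchOut; punchOut-injective;
         pigeonhole; any?; _≟_; suc-injective)
open import Data.Fin.Relation.Unary.Top using (view; ‵fromℕ; ‵inject₁)
open import Data.Vec as Vec using (Vec; []; _∷_; lookup; _∷ʳ_; tabulate)
open import Data.Vec.Properties using (lookup-map; ∷ʳ-injective; ∷-injective; lookup∘tabulate; tabulate∘lookup; tabulate-cong)
open import Data.List as List using (List; []; _∷_; _++_; length; allFin; cartesianProductWith)
open import Data.List.Properties using (length-++; length-map; length-tabulate)
open import Data.List.Membership.Propositional using (_∈_)
open import Data.List.Membership.Propositional.Properties
  using (∈-map⁺; ∈-map⁻; ∈-++⁺ˡ; ∈-++⁺ʳ; ∈-++⁻; ∈-allFin; ∈-cartesianProductWith⁺; ∈-cartesianProductWith⁻)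
open import Data.List.Relation.Unary.Any using (here)
open import Data.List.Relation.Unary.All using ([]; _∷_)
open import Data.List.Relation.Unary.AllPairs using ([]; _∷_)
open import Data.List.Relation.Unary.Unique.Propositional using (Unique)
import Data.List.Relation.Unary.Unique.Propositional.Properties as Unique
open import Data.Product using (Σ; _×_; _,_; proj₁)
open import Data.Sum using (_⊎_; inj₁; inj₂; [_,_]′)
open import Data.Empty using (⊥; ⊥-elim)
open import Function using (_∘_)
open import Function.Bundles using (_⇔_; mk⇔; Equivalence)
open import Relation.Nullary using (¬_; Dec; yes; no)
open import Relation.Nullary.Decidable using (_×-dec_; _⊎-dec_)
open import Relation.Binary.Definitions using (tri<; tri≈; tri>)
open import Relation.Binary.PropositionalEquality
  using (_≡_; _≢_; refl; sym; trans; cong; cong₂; subst; subst₂; module ≡-Reasoning)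

open Equivalence using (to; from)

-- Characterisation of the avoiders

values : ∀ {n} → Vec (Fin n) n → Fin n → ℕ
values π i = toℕ (lookup π i)

AscentWitness : ∀ {n} → (Fin n → ℕ) → Fin n → Fin n → Set
AscentWitness {n} f i i' = Σ (Fin n) λ k → toℕ k < toℕ i × ((f i < f k × f k < f i') ⊎ f k < f i)

-- AscentCond π unfolds to AscentCondOn (values π).
AscentCondOn : ∀ {n} → (Fin n → ℕ) → Set
AscentCondOn f = ∀ i i' → toℕ i' ≡ suc (toℕ i) → f i < f i' → AscentWitness f i i'

ascentWitness? : ∀ {n} (f : Fin n → ℕ) i i' → Dec (AscentWitness f i i')
ascentWitness? f i i' = any? λ k →
  (toℕ k <? toℕ i) ×-dec (((f i <? f k) ×-dec (f k <? f i')) ⊎-dec (f k <? f i))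

avoids⇒ascentCond : ∀ {n} (π : Vec (Fin n) n) → Avoids pR π → AscentCond π
avoids⇒ascentCond π avoid i i' i'≡1+i ascent with ascentWitness? (values π) i i'
... | yes witness = witness
... | no ¬witness = ⊥-elim (avoid (i , i' , i<i' , ascent , box₀₀ ∷ box₀₁ ∷ column₁ {f0} ∷ column₁ {f1} ∷ column₁ {f2} ∷ []))
  where
  i<i' : toℕ i < toℕ i'
  i<i' = subst (toℕ i <_) (sym i'≡1+i) (n<1+n (toℕ i))
  box₀₀ : BoxEmpty π i i' (f0 , f0)
  box₀₀ x ((_ , s≤s x<i) , (_ , s≤s πx<πi)) = ¬witness (x , x<i , inj₂ πx<πi)
  box₀₁ : BoxEmpty π i i' (f0 , f1)
  box₀₁ x ((_ , s≤s x<i) , (s≤s πi<πx , s≤s πx<πi')) = ¬witness (x , x<i , inj₁ (πi<πx , πx<πi'))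
  column₁ : ∀ {b} → BoxEmpty π i i' (f1 , b)
  column₁ x ((s≤s i<x , s≤s x<i') , _) = <⇒≱ i<x (s≤s⁻¹ (subst (toℕ x <_) i'≡1+i x<i'))

column₁-occupied : ∀ {n} (π : Vec (Fin n) n) → IsPerm π → ∀ {i j} → suc (toℕ i) < toℕ j →
  BoxEmpty π i j (f1 , f0) → BoxEmpty π i j (f1 , f1) → BoxEmpty π i j (f1 , f2) → ⊥
column₁-occupied {n} π perm {i} {j} 1+i<j box₁₀ box₁₁ box₁₂ = occupied
  where
  x : Fin n
  x = fromℕ< (<-trans 1+i<j (toℕ<n j))
  toℕx : toℕ x ≡ suc (toℕ i)
  toℕx = toℕ-fromℕ< (<-trans 1+i<j (toℕ<n j))
  inColumn₁ : suc (toℕ i) < suc (toℕ x) × suc (toℕ x) < suc (toℕ j)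
  inColumn₁ = s≤s (subst (toℕ i <_) (sym toℕx) (n<1+n (toℕ i))) , s≤s (subst (_< toℕ j) (sym toℕx) 1+i<j)
  occupied : ⊥
  occupied with <-cmp (values π x) (values π i)
  ... | tri< πx<πi _ _ = box₁₀ x (inColumn₁ , (s≤s z≤n , s≤s πx<πi))
  ... | tri≈ _ πx≡πi _ = 1+n≢n (trans (sym toℕx) (cong toℕ (perm x i (toℕ-injective πx≡πi))))
  ... | tri> _ _ πi<πx with <-cmp (values π x) (values π j)
  ...   | tri< πx<πj _ _ = box₁₁ x (inColumn₁ , (s≤s πi<πx , s≤s πx<πj))
  ...   | tri≈ _ πx≡πj _ = <⇒≢ (subst (_< toℕ j) (sym toℕx) 1+i<j) (cong toℕ (perm x j (toℕ-injective πx≡πj)))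
  ...   | tri> _ _ πj<πx = box₁₂ x (inColumn₁ , (s≤s πj<πx , s≤s (toℕ<n (lookup π x))))

ascentCond⇒avoids : ∀ {n} (π : Vec (Fin n) n) → IsPerm π → AscentCond π → Avoids pR π
ascentCond⇒avoids π perm H (i , j , i<j , πi<πj , box₀₀ ∷ box₀₁ ∷ box₁₀ ∷ box₁₁ ∷ box₁₂ ∷ [])
  with m≤n⇒m<n∨m≡n i<j
... | inj₁ 1+i<j = column₁-occupied π perm 1+i<j box₁₀ box₁₁ box₁₂
... | inj₂ 1+i≡j with H i j (sym 1+i≡j) πi<πj
...   | k , k<i , inj₁ (πi<πk , πk<πj) = box₀₁ k ((s≤s z≤n , s≤s k<i) , (s≤s πi<πk , s≤s πk<πj))
...   | k , k<i , inj₂ πk<πi = box₀₀ k ((s≤s z≤n , s≤s k<i) , (s≤s z≤n , s≤s πk<πi))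

avoids⇔ascentCond : ∀ n (π : Vec (Fin n) n) → IsPerm π → Avoids pR π ⇔ AscentCond π
avoids⇔ascentCond n π perm = mk⇔ (avoids⇒ascentCond π) (ascentCond⇒avoids π perm)

-- Appending a last entry

witness-transport : ∀ {n} {f g : Fin n → ℕ} → (∀ a b → f a < f b → g a < g b) →
  ∀ {i i'} → AscentWitness f i i' → AscentWitness g i i'
witness-transport f⇒g (k , k<i , inj₁ (fi<fk , fk<fi')) = k , k<i , inj₁ (f⇒g _ k fi<fk , f⇒g k _ fk<fi')
witness-transport f⇒g (k , k<i , inj₂ fk<fi) = k , k<i , inj₂ (f⇒g k _ fk<fi)

ascentCondOn-transport : ∀ {n} {f g : Fin n → ℕ} →
  (∀ a b → f a < f b → g a < g b) → (∀ a b → g a < g b → f a < f b) → AscentCondOn f → AscentCondOn g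
ascentCondOn-transport f⇒g g⇒f H i i' i'≡1+i gi<gi' = witness-transport f⇒g (H i i' i'≡1+i (g⇒f i i' gi<gi'))

LastAscentCond : ∀ {n} → (Fin (suc n) → ℕ) → Set
LastAscentCond {n} f =
  ∀ j → suc (toℕ j) ≡ n → f (inject₁ j) < f (fromℕ n) → AscentWitness f (inject₁ j) (fromℕ n)

inject₁-successor⇔ : ∀ {n} (j j' : Fin n) → toℕ (inject₁ j') ≡ suc (toℕ (inject₁ j)) ⇔ toℕ j' ≡ suc (toℕ j)
inject₁-successor⇔ j j' = mk⇔ (subst₂ (λ a b → a ≡ suc b) (toℕ-inject₁ j') (toℕ-inject₁ j))
  (subst₂ (λ a b → a ≡ suc b) (sym (toℕ-inject₁ j')) (sym (toℕ-inject₁ j)))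

ascentCondOn-init : ∀ {n} (f : Fin (suc n) → ℕ) → AscentCondOn f → AscentCondOn (f ∘ inject₁)
ascentCondOn-init f H j j' j'≡1+j ascent
  with H (inject₁ j) (inject₁ j') (from (inject₁-successor⇔ j j') j'≡1+j) ascent
... | k , k<j , between with view k
...   | ‵fromℕ = ⊥-elim (<-asym (toℕ<n j) (subst₂ _<_ (toℕ-fromℕ _) (toℕ-inject₁ j) k<j))
...   | ‵inject₁ k' = k' , subst₂ _<_ (toℕ-inject₁ k') (toℕ-inject₁ j) k<j , between

ascentCondOn-snoc : ∀ {n} (f : Fin (suc n) → ℕ) → AscentCondOn (f ∘ inject₁) → LastAscentCond f → AscentCondOn f
ascentCondOn-snoc f H last i i' i'≡1+i ascent with view i' | view i
... | ‵fromℕ | ‵fromℕ = ⊥-elim (1+n≢n (sym i'≡1+i))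
... | ‵fromℕ | ‵inject₁ j = last j (trans (cong suc (sym (toℕ-inject₁ j))) (trans (sym i'≡1+i) (toℕ-fromℕ _))) ascent
... | ‵inject₁ j' | ‵fromℕ =
  ⊥-elim (<-asym (toℕ<n j') (subst₂ _<_ (toℕ-fromℕ _) (trans (sym i'≡1+i) (toℕ-inject₁ j')) (n<1+n _)))
... | ‵inject₁ j' | ‵inject₁ j with H j j' (to (inject₁-successor⇔ j j') i'≡1+i) ascent
...   | k , k<j , between = inject₁ k , subst₂ _<_ (sym (toℕ-inject₁ k)) (sym (toℕ-inject₁ j)) k<j , between

lookup-∷ʳ-last : ∀ {A : Set} {n} (xs : Vec A n) x → lookup (xs ∷ʳ x) (fromℕ n) ≡ x
lookup-∷ʳ-last [] x = refl
lookup-∷ʳ-last (y ∷ xs) x = lookup-∷ʳ-last xs x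

lookup-∷ʳ-inject₁ : ∀ {A : Set} {n} (xs : Vec A n) x j → lookup (xs ∷ʳ x) (inject₁ j) ≡ lookup xs j
lookup-∷ʳ-inject₁ (y ∷ xs) x zero = refl
lookup-∷ʳ-inject₁ (y ∷ xs) x (suc j) = lookup-∷ʳ-inject₁ xs x j

extend : ∀ {n} → Fin (suc n) → Vec (Fin n) n → Vec (Fin (suc n)) (suc n)
extend v σ = Vec.map (punchIn v) σ ∷ʳ v

lookup-extend-last : ∀ {n} v (σ : Vec (Fin n) n) → lookup (extend v σ) (fromℕ n) ≡ v
lookup-extend-last v σ = lookup-∷ʳ-last (Vec.map (punchIn v) σ) v

lookup-extend-inject₁ : ∀ {n} v (σ : Vec (Fin n) n) j → lookup (extend v σ) (inject₁ j) ≡ punchIn v (lookup σ j)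
lookup-extend-inject₁ v σ j = trans (lookup-∷ʳ-inject₁ (Vec.map (punchIn v) σ) v j) (lookup-map j (punchIn v) σ)

map-injective : ∀ {A B : Set} {n} (f : A → B) → (∀ {x y} → f x ≡ f y → x ≡ y) →
  (xs ys : Vec A n) → Vec.map f xs ≡ Vec.map f ys → xs ≡ ys
map-injective f f-inj [] [] _ = refl
map-injective f f-inj (x ∷ xs) (y ∷ ys) eq with ∷-injective eq
... | fx≡fy , eq' = cong₂ _∷_ (f-inj fx≡fy) (map-injective f f-inj xs ys eq')

extend-injective : ∀ {n} {v v' : Fin (suc n)} {σ σ' : Vec (Fin n) n} → extend v σ ≡ extend v' σ' → σ ≡ σ' × v ≡ v'
extend-injective {v = v} {σ = σ} {σ'} eq with ∷ʳ-injective (Vec.map (punchIn v) σ) _ eq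
... | mapσ≡mapσ' , refl = map-injective (punchIn v) (punchIn-injective v _ _) σ σ' mapσ≡mapσ' , refl

isPerm-extend⁺ : ∀ {n} v (σ : Vec (Fin n) n) → IsPerm σ → IsPerm (extend v σ)
isPerm-extend⁺ v σ perm i j eq with view i | view j
... | ‵fromℕ | ‵fromℕ = refl
... | ‵fromℕ | ‵inject₁ b =
  ⊥-elim (punchInᵢ≢i v (lookup σ b) (trans (sym (lookup-extend-inject₁ v σ b)) (trans (sym eq) (lookup-extend-last v σ))))
... | ‵inject₁ a | ‵fromℕ =
  ⊥-elim (punchInᵢ≢i v (lookup σ a) (trans (sym (lookup-extend-inject₁ v σ a)) (trans eq (lookup-extend-last v σ))))
... | ‵inject₁ a | ‵inject₁ b = cong inject₁ (perm a b (punchIn-injective v _ _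
  (trans (sym (lookup-extend-inject₁ v σ a)) (trans eq (lookup-extend-inject₁ v σ b)))))

isPerm-extend⁻ : ∀ {n} v (σ : Vec (Fin n) n) → IsPerm (extend v σ) → IsPerm σ
isPerm-extend⁻ v σ perm i j eq = inject₁-injective (perm (inject₁ i) (inject₁ j)
  (trans (lookup-extend-inject₁ v σ i) (trans (cong (punchIn v) eq) (sym (lookup-extend-inject₁ v σ j)))))

extend-surjective : ∀ {n} (π : Vec (Fin (suc n)) (suc n)) → IsPerm π →
  Σ (Fin (suc n)) λ v → Σ (Vec (Fin n) n) λ σ → extend v σ ≡ π
extend-surjective {n} π perm = v , σ , (begin
    extend v σ                       ≡⟨ sym (tabulate∘lookup (extend v σ)) ⟩
    tabulate (lookup (extend v σ))   ≡⟨ tabulate-cong lookup-extend ⟩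
    tabulate (lookup π)              ≡⟨ tabulate∘lookup π ⟩
    π                                ∎)
  where
  open ≡-Reasoning
  v : Fin (suc n)
  v = lookup π (fromℕ n)
  v≢ : ∀ j → v ≢ lookup π (inject₁ j)
  v≢ j eq = fromℕ≢inject₁ (perm _ _ eq)
  σ : Vec (Fin n) n
  σ = tabulate (λ j → punchOut (v≢ j))
  lookup-extend : ∀ i → lookup (extend v σ) i ≡ lookup π i
  lookup-extend i with view i
  ... | ‵fromℕ = lookup-extend-last v σ
  ... | ‵inject₁ j = begin
    lookup (extend v σ) (inject₁ j)  ≡⟨ lookup-extend-inject₁ v σ j ⟩
    punchIn v (lookup σ j)           ≡⟨ cong (punchIn v) (lookup∘tabulate _ j) ⟩
    punchIn v (punchOut (v≢ j))      ≡⟨ punchIn-punchOut (v≢ j) ⟩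
    lookup π (inject₁ j)             ∎

punchIn-mono-< : ∀ {n} i (a b : Fin n) → a Fin.< b → punchIn i a Fin.< punchIn i b
punchIn-mono-< i a b a<b = ≰⇒> (λ ↑b≤↑a → <⇒≱ a<b (punchIn-cancel-≤ i b a ↑b≤↑a))

punchIn-cancel-< : ∀ {n} i (a b : Fin n) → punchIn i a Fin.< punchIn i b → a Fin.< b
punchIn-cancel-< i a b ↑a<↑b = ≰⇒> (λ b≤a → <⇒≱ ↑a<↑b (punchIn-mono-≤ i b a b≤a))

punchIn-below : ∀ {n} (i : Fin (suc n)) (j : Fin n) → toℕ j < toℕ i → toℕ (punchIn i j) ≡ toℕ j
punchIn-below (suc i) zero _ = refl
punchIn-below (suc i) (suc j) (s≤s j<i) = cong suc (punchIn-below i j j<i)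

values-extend-inject₁ : ∀ {n} v (σ : Vec (Fin n) n) j → values (extend v σ) (inject₁ j) ≡ toℕ (punchIn v (lookup σ j))
values-extend-inject₁ v σ j = cong toℕ (lookup-extend-inject₁ v σ j)

values-extend-last : ∀ {n} v (σ : Vec (Fin n) n) → values (extend v σ) (fromℕ n) ≡ toℕ v
values-extend-last v σ = cong toℕ (lookup-extend-last v σ)

ascentCond-extend-init⇔ : ∀ {n} v (σ : Vec (Fin n) n) → AscentCondOn (values (extend v σ) ∘ inject₁) ⇔ AscentCond σ
ascentCond-extend-init⇔ v σ = mk⇔ (ascentCondOn-transport reflects preserves) (ascentCondOn-transport preserves reflects)
  where
  preserves : ∀ a b → values σ a < values σ b → values (extend v σ) (inject₁ a) < values (extend v σ) (inject₁ b)
  preserves a b σa<σb = subst₂ _<_ (sym (values-extend-inject₁ v σ a)) (sym (values-extend-inject₁ v σ b))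
    (punchIn-mono-< v _ _ σa<σb)
  reflects : ∀ a b → values (extend v σ) (inject₁ a) < values (extend v σ) (inject₁ b) → values σ a < values σ b
  reflects a b ↑a<↑b = punchIn-cancel-< v _ _
    (subst₂ _<_ (values-extend-inject₁ v σ a) (values-extend-inject₁ v σ b) ↑a<↑b)

ascentCondOn⇒lastAscentCond : ∀ {n} (f : Fin (suc n) → ℕ) → AscentCondOn f → LastAscentCond f
ascentCondOn⇒lastAscentCond {n} f H j 1+j≡n = H (inject₁ j) (fromℕ n)
  (trans (toℕ-fromℕ n) (trans (sym 1+j≡n) (cong suc (sym (toℕ-inject₁ j)))))

witness-by-trichotomy : ∀ {n} {f : Fin n → ℕ} {i i' k} → toℕ k < toℕ i → f k ≢ f i → f k < f i' → AscentWitness f i i'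
witness-by-trichotomy {f = f} {i} {k = k} k<i fk≢fi fk<fi' with <-cmp (f k) (f i)
... | tri< fk<fi _ _ = k , k<i , inj₂ fk<fi
... | tri≈ _ fk≡fi _ = ⊥-elim (fk≢fi fk≡fi)
... | tri> _ _ fi<fk = k , k<i , inj₁ (fi<fk , fk<fi')

EndsIn0 : ∀ {n} → Vec (Fin n) n → Set
EndsIn0 {n} σ = Σ (Fin n) λ j → suc (toℕ j) ≡ n × toℕ (lookup σ j) ≡ 0

lastAscentCond-extend-fails : ∀ {n} v (σ : Vec (Fin n) n) → EndsIn0 σ → toℕ v ≡ 1 → ¬ LastAscentCond (values (extend v σ))
lastAscentCond-extend-fails {n} v σ (j , 1+j≡n , σj≡0) v≡1 last =
  noWitness (last j 1+j≡n (subst₂ _<_ (sym fj≡0) (sym flast≡1) (s≤s z≤n)))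
  where
  f : Fin (suc n) → ℕ
  f = values (extend v σ)
  fj≡0 : f (inject₁ j) ≡ 0
  fj≡0 = trans (values-extend-inject₁ v σ j)
    (trans (punchIn-below v (lookup σ j) (subst₂ _<_ (sym σj≡0) (sym v≡1) (s≤s z≤n))) σj≡0)
  flast≡1 : f (fromℕ n) ≡ 1
  flast≡1 = trans (values-extend-last v σ) v≡1
  noWitness : ¬ AscentWitness f (inject₁ j) (fromℕ n)
  noWitness (k , _ , inj₁ (fj<fk , fk<flast)) =
    <⇒≱ (subst (_< f k) fj≡0 fj<fk) (s≤s⁻¹ (subst (f k <_) flast≡1 fk<flast))
  noWitness (k , _ , inj₂ fk<fj) = n≮0 (subst (f k <_) fj≡0 fk<fj)

-- A missed value y would make punchOut y ∘ lookup σ an injection Fin (1 + m) → Fin m.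
isPerm⇒surjective : ∀ {n} (σ : Vec (Fin n) n) → IsPerm σ → ∀ y → Σ (Fin n) λ p → lookup σ p ≡ y
isPerm⇒surjective {suc m} σ perm y with any? (λ p → lookup σ p ≟ y)
... | yes hit = hit
... | no miss = ⊥-elim collision
  where
  y≢σ : ∀ p → y ≢ lookup σ p
  y≢σ p eq = miss (p , sym eq)
  collision : ⊥
  collision with pigeonhole (n<1+n m) (λ p → punchOut (y≢σ p))
  ... | a , b , a<b , eq = <-irrefl (cong toℕ (perm a b (punchOut-injective (y≢σ a) (y≢σ b) eq))) a<b

entry≤1-elsewhere : ∀ {m} (σ : Vec (Fin (suc (suc m))) (suc (suc m))) → IsPerm σ →
  ∀ j → Σ (Fin (suc (suc m))) λ p → p ≢ j × toℕ (lookup σ p) ≤ 1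
entry≤1-elsewhere σ perm j with isPerm⇒surjective σ perm zero | isPerm⇒surjective σ perm (suc zero)
... | p₀ , σp₀≡0 | p₁ , σp₁≡1 with p₀ ≟ j
...   | no p₀≢j = p₀ , p₀≢j , subst (λ y → toℕ y ≤ 1) (sym σp₀≡0) z≤n
...   | yes refl = p₁ , (λ p₁≡p₀ → 0≢1 (trans (sym σp₀≡0) (trans (cong (lookup σ) (sym p₁≡p₀)) σp₁≡1))) ,
                   subst (λ y → toℕ y ≤ 1) (sym σp₁≡1) (s≤s z≤n)
  where
  0≢1 : zero ≢ suc zero
  0≢1 ()

-- For v ≥ 2, an entry of σ with value 0 or 1 other than the last one is a witness.
lastAscentCond-extend : ∀ {n} v (σ : Vec (Fin n) n) → IsPerm σ → ¬ (EndsIn0 σ × toℕ v ≡ 1) →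
  LastAscentCond (values (extend v σ))
lastAscentCond-extend zero σ perm ok j 1+j≡n ascent =
  ⊥-elim (n≮0 (subst₂ _<_ (values-extend-inject₁ zero σ j) (values-extend-last zero σ) ascent))
lastAscentCond-extend {suc m} (suc zero) σ perm ok j 1+j≡n ascent
  with lookup σ j in σj≡ | subst₂ _<_ (values-extend-inject₁ (suc zero) σ j) (values-extend-last (suc zero) σ) ascent
... | zero | _ = ⊥-elim (ok ((j , 1+j≡n , cong toℕ σj≡) , refl))
... | suc _ | s≤s ()
lastAscentCond-extend {suc (suc m)} v@(suc (suc w)) σ perm ok j 1+j≡n ascent with entry≤1-elsewhere σ perm j
... | p , p≢j , σp≤1 = witness-by-trichotomy p<j fp≢fj fp<flast
  where
  f : Fin (suc (suc (suc m))) → ℕ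
  f = values (extend v σ)
  p<j : toℕ (inject₁ p) < toℕ (inject₁ j)
  p<j = subst₂ _<_ (sym (toℕ-inject₁ p)) (sym (toℕ-inject₁ j))
    (≤∧≢⇒< (s≤s⁻¹ (subst (toℕ p <_) (sym 1+j≡n) (toℕ<n p))) (p≢j ∘ toℕ-injective))
  fp≢fj : f (inject₁ p) ≢ f (inject₁ j)
  fp≢fj eq = p≢j (inject₁-injective (isPerm-extend⁺ v σ perm _ _ (toℕ-injective eq)))
  fp<flast : f (inject₁ p) < f (fromℕ (suc (suc m)))
  fp<flast = subst₂ _<_ (sym (trans (values-extend-inject₁ v σ p) (punchIn-below v _ σp<v)))
    (sym (values-extend-last v σ)) σp<v
    where
    σp<v : toℕ (lookup σ p) < toℕ v
    σp<v = s≤s (≤-trans σp≤1 (s≤s z≤n))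

Good : ∀ {n} → Vec (Fin n) n → Set
Good π = IsPerm π × AscentCond π

good-extend⇔ : ∀ {n} v (σ : Vec (Fin n) n) → Good (extend v σ) ⇔ (Good σ × ¬ (EndsIn0 σ × toℕ v ≡ 1))
good-extend⇔ {n} v σ = mk⇔ restrict (λ ((perm , ascentCond) , ok) → isPerm-extend⁺ v σ perm ,
    ascentCondOn-snoc f (from (ascentCond-extend-init⇔ v σ) ascentCond) (lastAscentCond-extend v σ perm ok))
  where
  f : Fin (suc n) → ℕ
  f = values (extend v σ)
  restrict : Good (extend v σ) → Good σ × ¬ (EndsIn0 σ × toℕ v ≡ 1)
  restrict (perm , ascentCond) = (isPerm-extend⁻ v σ perm , to (ascentCond-extend-init⇔ v σ) (ascentCondOn-init f ascentCond)) ,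
    λ (ends0 , v≡1) → lastAscentCond-extend-fails v σ ends0 v≡1 (ascentCondOn⇒lastAscentCond f ascentCond)

endsIn0-extend⇔ : ∀ {n} v (σ : Vec (Fin n) n) → EndsIn0 (extend v σ) ⇔ toℕ v ≡ 0
endsIn0-extend⇔ {n} v σ = mk⇔ lastIs0 (λ v≡0 → fromℕ n , cong suc (toℕ-fromℕ n) , trans (values-extend-last v σ) v≡0)
  where
  lastIs0 : EndsIn0 (extend v σ) → toℕ v ≡ 0
  lastIs0 (j , 1+j≡1+n , πj≡0) with view j
  ... | ‵fromℕ = trans (sym (values-extend-last v σ)) πj≡0
  ... | ‵inject₁ j' = ⊥-elim (<-irrefl (trans (sym (toℕ-inject₁ j')) (cong pred 1+j≡1+n)) (toℕ<n j'))

-- Enumeration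

valuesFrom1 : ∀ n → List (Fin (suc n))
valuesFrom1 n = List.map suc (allFin n)

valuesFrom2 : ∀ n → List (Fin (suc n))
valuesFrom2 zero = []
valuesFrom2 (suc n) = List.map suc (valuesFrom1 n)

∈valuesFrom1⇒1≤ : ∀ {n v} → v ∈ valuesFrom1 n → 1 ≤ toℕ v
∈valuesFrom1⇒1≤ v∈ with ∈-map⁻ suc v∈
... | _ , _ , refl = s≤s z≤n

∈valuesFrom2⇒2≤ : ∀ {n v} → v ∈ valuesFrom2 n → 2 ≤ toℕ v
∈valuesFrom2⇒2≤ {suc n} v∈ with ∈-map⁻ suc v∈
... | u , u∈ , refl = s≤s (∈valuesFrom1⇒1≤ u∈)

extensions : ∀ {n} → List (Vec (Fin n) n) → List (Fin (suc n)) → List (Vec (Fin (suc n)) (suc n))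
extensions = cartesianProductWith (λ σ v → extend v σ)

goodEnding0 goodEndingAbove0 goodPerms : ∀ n → List (Vec (Fin n) n)
goodEnding0 zero = []
goodEnding0 (suc n) = List.map (extend zero) (goodPerms n)
goodEndingAbove0 zero = [] ∷ []
goodEndingAbove0 (suc n) = extensions (goodEnding0 n) (valuesFrom2 n) ++ extensions (goodEndingAbove0 n) (valuesFrom1 n)
goodPerms n = goodEnding0 n ++ goodEndingAbove0 n

∈goodEnding0⇒endsIn0 : ∀ {n π} → π ∈ goodEnding0 n → EndsIn0 π
∈goodEnding0⇒endsIn0 {suc n} π∈ with ∈-map⁻ (extend zero) π∈
... | σ , _ , refl = from (endsIn0-extend⇔ zero σ) refl

∈goodEndingAbove0⇒¬endsIn0 : ∀ {n π} → π ∈ goodEndingAbove0 n → ¬ EndsIn0 π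
∈goodEndingAbove0⇒¬endsIn0 {zero} (here refl) (() , _)
∈goodEndingAbove0⇒¬endsIn0 {suc n} π∈ with ∈-++⁻ (extensions (goodEnding0 n) (valuesFrom2 n)) π∈
... | inj₁ π∈₀ with ∈-cartesianProductWith⁻ _ (goodEnding0 n) (valuesFrom2 n) π∈₀
...   | σ , v , _ , v∈ , refl = λ ends0 → <⇒≢ (≤-trans (s≤s z≤n) (∈valuesFrom2⇒2≤ v∈)) (sym (to (endsIn0-extend⇔ v σ) ends0))
∈goodEndingAbove0⇒¬endsIn0 {suc n} π∈ | inj₂ π∈₊ with ∈-cartesianProductWith⁻ _ (goodEndingAbove0 n) (valuesFrom1 n) π∈₊
...   | σ , v , _ , v∈ , refl = λ ends0 → <⇒≢ (∈valuesFrom1⇒1≤ v∈) (sym (to (endsIn0-extend⇔ v σ) ends0))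

goodPerms-sound : ∀ n π → π ∈ goodPerms n → Good π
goodPerms-sound zero .[] (here refl) = (λ ()) , (λ ())
goodPerms-sound (suc n) π π∈ with ∈-++⁻ (goodEnding0 (suc n)) π∈
... | inj₁ π∈₀ with ∈-map⁻ (extend zero) π∈₀
...   | σ , σ∈ , refl = from (good-extend⇔ zero σ) (goodPerms-sound n σ σ∈ , λ ())
goodPerms-sound (suc n) π π∈ | inj₂ π∈₊ with ∈-++⁻ (extensions (goodEnding0 n) (valuesFrom2 n)) π∈₊
... | inj₁ π∈ext₀ with ∈-cartesianProductWith⁻ _ (goodEnding0 n) (valuesFrom2 n) π∈ext₀
...   | σ , v , σ∈ , v∈ , refl = from (good-extend⇔ v σ)
        (goodPerms-sound n σ (∈-++⁺ˡ σ∈) , λ (_ , v≡1) → <⇒≢ (∈valuesFrom2⇒2≤ v∈) (sym v≡1))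
goodPerms-sound (suc n) π π∈ | inj₂ π∈₊ | inj₂ π∈ext₊ with ∈-cartesianProductWith⁻ _ (goodEndingAbove0 n) (valuesFrom1 n) π∈ext₊
...   | σ , v , σ∈ , _ , refl = from (good-extend⇔ v σ)
        (goodPerms-sound n σ (∈-++⁺ʳ (goodEnding0 n) σ∈) , λ (ends0 , _) → ∈goodEndingAbove0⇒¬endsIn0 σ∈ ends0)

extend-∈goodPerms : ∀ {n} v (σ : Vec (Fin n) n) → ¬ (EndsIn0 σ × toℕ v ≡ 1) →
  σ ∈ goodEnding0 n ⊎ σ ∈ goodEndingAbove0 n → extend v σ ∈ goodEnding0 (suc n) ⊎ extend v σ ∈ goodEndingAbove0 (suc n)
extend-∈goodPerms {n} zero σ _ σ∈ = inj₁ (∈-map⁺ (extend zero) ([ ∈-++⁺ˡ , ∈-++⁺ʳ (goodEnding0 n) ]′ σ∈))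
extend-∈goodPerms {n} (suc w) σ _ (inj₂ σ∈) = inj₂ (∈-++⁺ʳ (extensions (goodEnding0 n) (valuesFrom2 n))
  (∈-cartesianProductWith⁺ _ σ∈ (∈-map⁺ suc (∈-allFin w))))
extend-∈goodPerms (suc zero) σ ok (inj₁ σ∈) = ⊥-elim (ok (∈goodEnding0⇒endsIn0 σ∈ , refl))
extend-∈goodPerms (suc (suc w)) σ _ (inj₁ σ∈) =
  inj₂ (∈-++⁺ˡ (∈-cartesianProductWith⁺ _ σ∈ (∈-map⁺ suc (∈-map⁺ suc (∈-allFin w)))))

goodPerms-complete : ∀ n π → Good π → π ∈ goodEnding0 n ⊎ π ∈ goodEndingAbove0 n
goodPerms-complete zero [] _ = inj₂ (here refl)
goodPerms-complete (suc n) π (perm , ascentCond) with extend-surjective π perm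
... | v , σ , refl with to (good-extend⇔ v σ) (perm , ascentCond)
...   | goodσ , ok = extend-∈goodPerms v σ ok (goodPerms-complete n σ goodσ)

goodEnding0-disjoint : ∀ {n π} → ¬ (π ∈ goodEnding0 n × π ∈ goodEndingAbove0 n)
goodEnding0-disjoint (π∈₀ , π∈₊) = ∈goodEndingAbove0⇒¬endsIn0 π∈₊ (∈goodEnding0⇒endsIn0 π∈₀)

unique-valuesFrom1 : ∀ n → Unique (valuesFrom1 n)
unique-valuesFrom1 n = Unique.map⁺ suc-injective (Unique.allFin⁺ n)

unique-valuesFrom2 : ∀ n → Unique (valuesFrom2 n)
unique-valuesFrom2 zero = []
unique-valuesFrom2 (suc n) = Unique.map⁺ suc-injective (unique-valuesFrom1 n)

unique-goodEnding0 : ∀ n → Unique (goodEnding0 n)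
unique-goodEndingAbove0 : ∀ n → Unique (goodEndingAbove0 n)
unique-goodPerms : ∀ n → Unique (goodPerms n)

unique-goodEnding0 zero = []
unique-goodEnding0 (suc n) = Unique.map⁺ (proj₁ ∘ extend-injective) (unique-goodPerms n)

unique-goodEndingAbove0 zero = [] ∷ []
unique-goodEndingAbove0 (suc n) = Unique.++⁺
  (Unique.cartesianProductWith⁺ _ extend-injective (unique-goodEnding0 n) (unique-valuesFrom2 n))
  (Unique.cartesianProductWith⁺ _ extend-injective (unique-goodEndingAbove0 n) (unique-valuesFrom1 n))
  disjoint
  where
  disjoint : ∀ {π} → ¬ (π ∈ extensions (goodEnding0 n) (valuesFrom2 n) × π ∈ extensions (goodEndingAbove0 n) (valuesFrom1 n))
  disjoint (π∈₀ , π∈₊)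
    with ∈-cartesianProductWith⁻ _ (goodEnding0 n) (valuesFrom2 n) π∈₀
       | ∈-cartesianProductWith⁻ _ (goodEndingAbove0 n) (valuesFrom1 n) π∈₊
  ... | σ , v , σ∈₀ , _ , eq | σ' , v' , σ'∈₊ , _ , eq' with extend-injective (trans (sym eq) eq')
  ...   | refl , _ = goodEnding0-disjoint (σ∈₀ , σ'∈₊)

unique-goodPerms n = Unique.++⁺ (unique-goodEnding0 n) (unique-goodEndingAbove0 n) goodEnding0-disjoint

-- Counting

length-cartesianProductWith : ∀ {A B C : Set} (f : A → B → C) xs ys →
  length (cartesianProductWith f xs ys) ≡ length xs * length ys
length-cartesianProductWith f [] ys = refl
length-cartesianProductWith f (x ∷ xs) ys = begin
  length (List.map (f x) ys ++ cartesianProductWith f xs ys)      ≡⟨ length-++ (List.map (f x) ys) ⟩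
  length (List.map (f x) ys) + length (cartesianProductWith f xs ys) ≡⟨ cong₂ _+_ (length-map (f x) ys) (length-cartesianProductWith f xs ys) ⟩
  length ys + length xs * length ys                               ∎
  where open ≡-Reasoning

length-valuesFrom1 : ∀ n → length (valuesFrom1 n) ≡ n
length-valuesFrom1 n = trans (length-map suc (allFin n)) (length-tabulate (λ i → i))

length-valuesFrom2 : ∀ n → length (valuesFrom2 (suc n)) ≡ n
length-valuesFrom2 n = trans (length-map suc (valuesFrom1 n)) (length-valuesFrom1 n)

count : ℕ → ℕ
count n = length (goodPerms n)

length-goodEnding0 : ∀ n → length (goodEnding0 (suc n)) ≡ count n
length-goodEnding0 n = length-map (extend zero) (goodPerms n)

length-goodEndingAbove0 : ∀ m → length (goodEndingAbove0 (suc (suc m))) ≡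
  length (goodEnding0 (suc m)) * m + length (goodEndingAbove0 (suc m)) * suc m
length-goodEndingAbove0 m = begin
  length (extensions Z (valuesFrom2 (suc m)) ++ extensions N (valuesFrom1 (suc m)))
    ≡⟨ length-++ (extensions Z (valuesFrom2 (suc m))) ⟩
  length (extensions Z (valuesFrom2 (suc m))) + length (extensions N (valuesFrom1 (suc m)))
    ≡⟨ cong₂ _+_ (length-cartesianProductWith _ Z (valuesFrom2 (suc m))) (length-cartesianProductWith _ N (valuesFrom1 (suc m))) ⟩
  length Z * length (valuesFrom2 (suc m)) + length N * length (valuesFrom1 (suc m))
    ≡⟨ cong₂ (λ a b → length Z * a + length N * b) (length-valuesFrom2 m) (length-valuesFrom1 (suc m)) ⟩
  length Z * m + length N * suc m ∎
  where
  open ≡-Reasoning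
  Z N : List (Vec (Fin (suc m)) (suc m))
  Z = goodEnding0 (suc m)
  N = goodEndingAbove0 (suc m)

count-recurrence : ∀ m → count (suc (suc m)) + count m ≡ suc (suc m) * count (suc m)
count-recurrence m = begin
  count (2+m) + count m
    ≡⟨ cong (_+ count m) (length-++ (goodEnding0 (2+m))) ⟩
  (length (goodEnding0 (2+m)) + length (goodEndingAbove0 (2+m))) + count m
    ≡⟨ cong₂ (λ a b → (a + b) + count m) (length-goodEnding0 (suc m)) (length-goodEndingAbove0 m) ⟩
  (count (suc m) + (c₀ * m + c₊ * suc m)) + count m
    ≡⟨ cong₂ (λ c d → (c + (c₀ * m + c₊ * suc m)) + d) (length-++ (goodEnding0 (suc m))) (sym (length-goodEnding0 m)) ⟩
  ((c₀ + c₊) + (c₀ * m + c₊ * suc m)) + c₀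
    ≡⟨ rearrange c₀ c₊ m ⟩
  suc (suc m) * (c₀ + c₊)
    ≡⟨ cong (suc (suc m) *_) (sym (length-++ (goodEnding0 (suc m)))) ⟩
  suc (suc m) * count (suc m) ∎
  where
  open ≡-Reasoning
  2+m c₀ c₊ : ℕ
  2+m = suc (suc m)
  c₀ = length (goodEnding0 (suc m))
  c₊ = length (goodEndingAbove0 (suc m))
  rearrange : ∀ c₀ c₊ m → ((c₀ + c₊) + (c₀ * m + c₊ * suc m)) + c₀ ≡ suc (suc m) * (c₀ + c₊)
  rearrange = solve-∀

count-avoiders : ∀ n → CardAvoiders pR n (count n)
count-avoiders n = goodPerms n , unique-goodPerms n , membership , refl
  where
  membership : ∀ π → (π ∈ goodPerms n) ⇔ (IsPerm π × Avoids pR π)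
  membership π = mk⇔
    (λ π∈ → let (perm , ascentCond) = goodPerms-sound n π π∈ in perm , from (avoids⇔ascentCond n π perm) ascentCond)
    (λ (perm , avoid) → [ ∈-++⁺ˡ , ∈-++⁺ʳ (goodEnding0 n) ]′
      (goodPerms-complete n π (perm , to (avoids⇔ascentCond n π perm) avoid)))

proposition4p18 :
    ((n : ℕ) (π : Vec (Fin n) n) → IsPerm π → (Avoids pR π ⇔ AscentCond π))
    × Σ (ℕ → ℕ) (λ a →
        ((n : ℕ) → CardAvoiders pR n (a n))
        × a 0 ≡ 1
        × a 1 ≡ 1 * a 0
        × ((m : ℕ) → a (suc (suc m)) + a m ≡ suc (suc m) * a (suc m)))
proposition4p18 = avoids⇔ascentCond , count , count-avoiders , refl , refl , count-recurrence
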